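{- For every graph $G$, ${\rm tree}\text{ - }{\rm tw}(G)+1 \le {\rm tree}\text{ - }\alpha(G)\cdot {\rm tree}\text{ - }\chi(G)$.
   Context: A tree-decomposition of a graph $G$ is a pair $(T,\{X_t\}_{t\in V(T)})$ where $T$ is a tree and $X_t\subseteq V(G)$, such that every edge of $G$ has both ends in some $X_t$ and for every vertex $v$ the nodes $t$ with $v\in X_t$ induce a non-empty connected subtree of $T$. ${\rm tw}(G)$ is the minimum over tree-decompositions of $\max_t|X_t|-1$. For a graph parameter $p$, ${\rm tree}\text{ - }p(G)$ is the minimum over all tree-decompositions of $G$ of $\max_t p(G[X_t])$; thus ${\rm tree}\text{ - }{\rm tw}(G)$ uses treewidth of bags, ${\rm tree}\text{ - }\alpha(G)$ uses independence number of bags, ${\rm tree}\text{ - }\chi(G)$ uses chromatic number of bags. -}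

module Defs where

open import Level using (Level; _⊔_; Lift) renaming (suc to lsuc; zero to lzero)
open import Data.Nat using (ℕ; suc; _≤_)
open import Data.Fin using (Fin)
open import Data.Fin.Subset using (Subset; _∈_; _⊆_; ∣_∣; ⊤)
open import Data.Product using (Σ; ∃; _×_)
open import Data.Sum using (_⊎_)
open import Relation.Nullary using (¬_; Dec)
open import Relation.Binary.PropositionalEquality using (_≡_; _≢_)

record Graph (n : ℕ) : Set₁ where
  field
    Adj    : Fin n → Fin n → Set
    adj?   : ∀ u v → Dec (Adj u v)
    sym    : ∀ {u v} → Adj u v → Adj v u
    irrefl : ∀ {u} → ¬ Adj u u
open Graph public

data Walk {m : ℕ} (E : Fin m → Fin m → Set) (P : Fin m → Set) : Fin m → Fin m → Set where
  here : ∀ {s} → P s → Walk E P s s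
  step : ∀ {s u t} → P s → E s u → Walk E P u t → Walk E P s t

ConnectedOn : {m : ℕ} → (Fin m → Fin m → Set) → (Fin m → Set) → Set
ConnectedOn E P = ∀ s t → P s → P t → Walk E P s t

AllV : {m : ℕ} → Fin m → Set
AllV _ = Data.Unit.⊤
  where import Data.Unit

-- A tree: a connected graph in which deleting any edge disconnects it
-- (minimally connected graph).
EdgeMinus : {m : ℕ} → Graph m → Fin m → Fin m → Fin m → Fin m → Set
EdgeMinus T u v x y = Adj T x y × ¬ ((x ≡ u × y ≡ v) ⊎ (x ≡ v × y ≡ u))

IsTree : {m : ℕ} → Graph m → Set
IsTree T = ConnectedOn (Adj T) AllV
         × (∀ u v → Adj T u v → ¬ Walk (EdgeMinus T u v) AllV u v)

-- Tree-decomposition of the induced subgraph G[X].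
-- The tree T has vertex set Fin (suc N) (non-empty).
record TreeDecomp {n : ℕ} (G : Graph n) (X : Subset n) : Set₁ where
  field
    N         : ℕ
    T         : Graph (suc N)
    isTree    : IsTree T
    bag       : Fin (suc N) → Subset n
    bag⊆      : ∀ t → bag t ⊆ X
    edgeCov   : ∀ u v → u ∈ X → v ∈ X → Adj G u v → ∃ λ t → u ∈ bag t × v ∈ bag t
    vertexCov : ∀ v → v ∈ X → ∃ λ t → v ∈ bag t
    subtree   : ∀ v → v ∈ X → ConnectedOn (Adj T) (λ t → v ∈ bag t)
open TreeDecomp public

IsMin : ∀ {ℓ} → (ℕ → Set ℓ) → ℕ → Set ℓ
IsMin P m = P m × (∀ k → P k → m ≤ k)

IsMax : ∀ {ℓ} → (ℕ → Set ℓ) → ℕ → Set ℓ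
IsMax P m = P m × (∀ k → P k → k ≤ m)

-- A graph parameter, evaluated on induced subgraphs G[X]:
-- p G X v means "p(G[X]) = v".
Param : Set₂
Param = ∀ {n} → Graph n → Subset n → ℕ → Set₁

-- tw(G[X]) + 1  =  min over tree-decompositions of G[X] of the max bag size.
-- (Working with tw+1 avoids the convention tw(empty graph) = -1.)
TwPlus1 : Param
TwPlus1 G X = IsMin (λ m → Σ (TreeDecomp G X) λ D → ∀ t → ∣ bag D t ∣ ≤ m)

Independent : ∀ {n} → Graph n → Subset n → Set
Independent G S = ∀ u v → u ∈ S → v ∈ S → ¬ Adj G u v

Alpha : Param
Alpha G X = IsMax (λ k → Lift (lsuc lzero)
  (∃ λ S → S ⊆ X × Independent G S × ∣ S ∣ ≡ k))

Chi : Param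
Chi {n} G X = IsMin (λ k → Lift (lsuc lzero)
  (Σ (Fin n → Fin k) λ c → ∀ u v → u ∈ X → v ∈ X → Adj G u v → c u ≢ c v))

TreeP : Param → ∀ {n} → Graph n → ℕ → Set₁
TreeP p G = IsMin (λ k → Σ (TreeDecomp G ⊤) λ D →
  ∀ t → ∃ λ v → p G (bag D t) v × v ≤ k)

{-# OPTIONS --safe #-}
module Submission where

-- Take a tree-decomposition Dα of G whose bags X all have α(G[X]) ≤ a and one,
-- Dχ, whose bags all have χ ≤ c. Restricting Dχ to a bag X of Dα gives a
-- tree-decomposition of G[X] in which every bag is properly c-coloured; each colour
-- class is independent in G[X], hence has at most a vertices, so every bag has at
-- most a·c vertices and tw(G[X]) + 1 ≤ a·c. Hence Dα itself witnesses
-- tree-tw(G) + 1 ≤ a·c.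
--
-- tw(G[X]) + 1 is an exact minimum over tree-decompositions, a family that is not
-- decidable, so it exists only classically. The argument therefore runs in the
-- double-negation monad, which is escaped at the end because t ≤ a * c is decidable.

open import Defs
open import Data.Nat using (ℕ; _≤_; _*_)
open import Data.Nat using (suc; _+_; _<_; _≟_; _≤?_; s≤s⁻¹)
open import Data.Nat.Induction using (<-rec)
open import Data.Nat.Properties
  using (≤-trans; ≤-reflexive; ≮⇒≥; ≤∧≢⇒<; n≮0; +-suc; +-mono-≤; *-monoˡ-≤; *-comm; module ≤-Reasoning)
open import Data.Bool.Properties using (T-≡)
open import Data.Fin using (Fin; toℕ)
open import Data.Fin.Properties using (toℕ<n; toℕ-injective; sequence)
open import Data.Fin.Subset using (Subset; _∈_; _⊆_; ∣_∣; ⊥; _∩_; ∁; inside; outside)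
open import Data.Fin.Subset.Properties
  using (∈⊤; x∈p∩q⁺; x∈p∩q⁻; p∩q⊆p; p∩q⊆q; x∈∁p⇒x∉p; p⊆q⇒∣p∣≤∣q∣; Empty-unique; ∣⊥∣≡0)
open import Data.Vec using ([]; _∷_; tabulate)
open import Data.Vec.Properties using (lookup∘tabulate; []=⇒lookup; lookup⇒[]=)
open import Data.Product using (∃; _×_; _,_; proj₁)
open import Function using (_∘_; Equivalence)
open import Level using (Level; lift)
open import Relation.Binary.PropositionalEquality as ≡ using (_≡_; _≢_; refl; trans; cong)
open import Relation.Nullary using (yes; no)
open import Relation.Nullary.Decidable using (isYes; toWitness; fromWitness; ¬¬-excluded-middle; decidable-stable)
open import Relation.Nullary.Negation using (DoubleNegation; ¬¬-map; ¬¬-Monad)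
open import Relation.Unary using (Pred; Decidable)
open import Effect.Monad using (RawMonad)

private
  variable
    ℓ : Level
    n k a c m : ℕ
    p q r X Y : Subset n

select : {P : Pred (Fin n) ℓ} → Decidable P → Subset n
select P? = tabulate (isYes ∘ P?)

module _ {P : Pred (Fin n) ℓ} (P? : Decidable P) {x : Fin n} where

  x∈select⁺ : P x → x ∈ select P?
  x∈select⁺ Px =
    lookup⇒[]= x _ (trans (lookup∘tabulate (isYes ∘ P?) x) (Equivalence.to T-≡ (fromWitness Px)))

  x∈select⁻ : x ∈ select P? → P x
  x∈select⁻ x∈ = toWitness (Equivalence.from T-≡
    (trans (≡.sym (lookup∘tabulate (isYes ∘ P?) x)) ([]=⇒lookup x∈)))

fibre : (Fin n → ℕ) → ℕ → Subset n
fibre f i = select (λ u → f u ≟ i)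

module _ (f : Fin n → ℕ) {i : ℕ} {x : Fin n} where

  x∈fibre⁺ : f x ≡ i → x ∈ fibre f i
  x∈fibre⁺ = x∈select⁺ (λ u → f u ≟ i)

  x∈fibre⁻ : x ∈ fibre f i → f x ≡ i
  x∈fibre⁻ = x∈select⁻ (λ u → f u ≟ i)

∩-monoˡ-⊆ : p ⊆ q → p ∩ r ⊆ q ∩ r
∩-monoˡ-⊆ {p = p} {r = r} p⊆q x∈p∩r with x∈p∩q⁻ p r x∈p∩r
... | x∈p , x∈r = x∈p∩q⁺ (p⊆q x∈p , x∈r)

∣p∣≡∣p∩q∣+∣p∩∁q∣ : (p q : Subset n) → ∣ p ∣ ≡ ∣ p ∩ q ∣ + ∣ p ∩ ∁ q ∣
∣p∣≡∣p∩q∣+∣p∩∁q∣ []            []            = refl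
∣p∣≡∣p∩q∣+∣p∩∁q∣ (outside ∷ p) (_ ∷ q)       = ∣p∣≡∣p∩q∣+∣p∩∁q∣ p q
∣p∣≡∣p∩q∣+∣p∩∁q∣ (inside ∷ p)  (inside ∷ q)  = cong suc (∣p∣≡∣p∩q∣+∣p∩∁q∣ p q)
∣p∣≡∣p∩q∣+∣p∩∁q∣ (inside ∷ p)  (outside ∷ q) =
  trans (cong suc (∣p∣≡∣p∩q∣+∣p∩∁q∣ p q)) (≡.sym (+-suc _ _))

∣p∣≤k*a : (col : Fin n → ℕ) (p : Subset n) → (∀ {u} → u ∈ p → col u < k) →
          (∀ i → ∣ p ∩ fibre col i ∣ ≤ a) → ∣ p ∣ ≤ k * a
∣p∣≤k*a {n = n} {k = 0} col p col<0 _ = ≤-reflexive (trans (cong ∣_∣ p≡⊥) (∣⊥∣≡0 n))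
  where
  p≡⊥ : p ≡ ⊥
  p≡⊥ = Empty-unique λ (_ , u∈p) → n≮0 (col<0 u∈p)
∣p∣≤k*a {k = suc k} {a = a} col p col<k+1 classes≤a = begin
  ∣ p ∣                                         ≡⟨ ∣p∣≡∣p∩q∣+∣p∩∁q∣ p (fibre col k) ⟩
  ∣ p ∩ fibre col k ∣ + ∣ p ∩ ∁ (fibre col k) ∣ ≤⟨ +-mono-≤ (classes≤a k) rest≤k*a ⟩
  a + k * a                                     ∎
  where
  open ≤-Reasoning
  col<k : ∀ {u} → u ∈ p ∩ ∁ (fibre col k) → col u < k
  col<k {u} u∈ with x∈p∩q⁻ p _ u∈
  ... | u∈p , u∈∁fibre = ≤∧≢⇒< (s≤s⁻¹ (col<k+1 u∈p)) (x∈∁p⇒x∉p u∈∁fibre ∘ x∈fibre⁺ col)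
  rest≤k*a : ∣ p ∩ ∁ (fibre col k) ∣ ≤ k * a
  rest≤k*a = ∣p∣≤k*a col _ col<k λ i →
    ≤-trans (p⊆q⇒∣p∣≤∣q∣ (∩-monoˡ-⊆ (p∩q⊆p p _))) (classes≤a i)

IsProperColouring : Graph n → Subset n → (Fin n → Fin k) → Set
IsProperColouring G X col = ∀ u v → u ∈ X → v ∈ X → Adj G u v → col u ≢ col v

IndependentSetsAtMost : Graph n → Subset n → ℕ → Set
IndependentSetsAtMost G X a = ∀ S → S ⊆ X → Independent G S → ∣ S ∣ ≤ a

Alpha⇒IndependentSetsAtMost : {G : Graph n} {α : ℕ} → Alpha G X α → α ≤ a →
                              IndependentSetsAtMost G X a
Alpha⇒IndependentSetsAtMost (_ , α-max) α≤a S S⊆X S-indep =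
  ≤-trans (α-max ∣ S ∣ (lift (S , S⊆X , S-indep , refl))) α≤a

IndependentSetsAtMost-mono : {G : Graph n} → Y ⊆ X →
                             IndependentSetsAtMost G X a → IndependentSetsAtMost G Y a
IndependentSetsAtMost-mono Y⊆X X-bound S S⊆Y = X-bound S (Y⊆X ∘ S⊆Y)

∣X∣≤k*a : (G : Graph n) (col : Fin n → Fin k) → IsProperColouring G X col →
          IndependentSetsAtMost G X a → ∣ X ∣ ≤ k * a
∣X∣≤k*a {X = X} G col proper X-bound =
  ∣p∣≤k*a (toℕ ∘ col) X (λ {u} _ → toℕ<n (col u)) λ i →
    X-bound _ (p∩q⊆p X _) (class-independent i)
  where
  class-independent : ∀ i → Independent G (X ∩ fibre (toℕ ∘ col) i)
  class-independent i u v u∈ v∈ uv with x∈p∩q⁻ X _ u∈ | x∈p∩q⁻ X _ v∈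
  ... | u∈X , u∈class | v∈X , v∈class = proper u v u∈X v∈X uv
    (toℕ-injective (trans (x∈fibre⁻ (toℕ ∘ col) u∈class) (≡.sym (x∈fibre⁻ (toℕ ∘ col) v∈class))))

walk-mono : {E : Fin m → Fin m → Set} {P Q : Fin m → Set} →
            (∀ {x} → P x → Q x) → ∀ {s t} → Walk E P s t → Walk E Q s t
walk-mono P⊆Q (here Ps)        = here (P⊆Q Ps)
walk-mono P⊆Q (step Ps su walk) = step (P⊆Q Ps) su (walk-mono P⊆Q walk)

restrict : {G : Graph n} → TreeDecomp G Y → (X : Subset n) → X ⊆ Y → TreeDecomp G X
restrict D X X⊆Y = record
  { N         = N D
  ; T         = T D
  ; isTree    = isTree D
  ; bag       = λ s → bag D s ∩ X
  ; bag⊆      = λ s → p∩q⊆q (bag D s) X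
  ; edgeCov   = λ u v u∈X v∈X uv → edge-in-bag u∈X v∈X (edgeCov D u v (X⊆Y u∈X) (X⊆Y v∈X) uv)
  ; vertexCov = λ v v∈X → vertex-in-bag v∈X (vertexCov D v (X⊆Y v∈X))
  ; subtree   = λ v v∈X s t v∈s v∈t → walk-mono (λ v∈ → x∈p∩q⁺ (v∈ , v∈X))
      (subtree D v (X⊆Y v∈X) s t (proj₁ (x∈p∩q⁻ (bag D s) X v∈s)) (proj₁ (x∈p∩q⁻ (bag D t) X v∈t)))
  }
  where
  edge-in-bag : ∀ {u v} → u ∈ X → v ∈ X → (∃ λ s → u ∈ bag D s × v ∈ bag D s) →
                ∃ λ s → u ∈ bag D s ∩ X × v ∈ bag D s ∩ X
  edge-in-bag u∈X v∈X (s , u∈s , v∈s) = s , x∈p∩q⁺ (u∈s , u∈X) , x∈p∩q⁺ (v∈s , v∈X)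
  vertex-in-bag : ∀ {v} → v ∈ X → (∃ λ s → v ∈ bag D s) → ∃ λ s → v ∈ bag D s ∩ X
  vertex-in-bag v∈X (s , v∈s) = s , x∈p∩q⁺ (v∈s , v∈X)

∣bag∩X∣≤a*c : {G : Graph n} (D : TreeDecomp G Y) → (∀ s → ∃ λ k → Chi G (bag D s) k × k ≤ c) →
              (X : Subset n) → IndependentSetsAtMost G X a → ∀ s → ∣ bag D s ∩ X ∣ ≤ a * c
∣bag∩X∣≤a*c {c = c} {a = a} {G = G} D χ-bags X X-bound s with χ-bags s
... | k , (lift (col , proper) , _) , k≤c = begin
  ∣ bag D s ∩ X ∣ ≤⟨ ∣X∣≤k*a G col proper-on-bag∩X bag∩X-bound ⟩
  k * a           ≤⟨ *-monoˡ-≤ a k≤c ⟩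
  c * a           ≡⟨ *-comm c a ⟩
  a * c           ∎
  where
  open ≤-Reasoning
  proper-on-bag∩X : IsProperColouring G (bag D s ∩ X) col
  proper-on-bag∩X u v u∈ v∈ = proper u v (p∩q⊆p _ _ u∈) (p∩q⊆p _ _ v∈)
  bag∩X-bound : IndependentSetsAtMost G (bag D s ∩ X) a
  bag∩X-bound = IndependentSetsAtMost-mono {G = G} (p∩q⊆q (bag D s) X) X-bound

¬¬-least : ∀ {ℓ} (P : Pred ℕ ℓ) {m : ℕ} → P m → DoubleNegation (∃ (IsMin P))
¬¬-least {ℓ} P {m} = <-rec (λ m → P m → DoubleNegation (∃ (IsMin P))) least-below m
  where
  open RawMonad (¬¬-Monad {a = ℓ}) using (pure; _>>=_)
  least-below : ∀ m → (∀ {k} → k < m → P k → DoubleNegation (∃ (IsMin P))) →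
                P m → DoubleNegation (∃ (IsMin P))
  least-below m rec Pm = ¬¬-excluded-middle {A = ∃ λ k → k < m × P k} >>= λ where
    (yes (k , k<m , Pk)) → rec k<m Pk
    (no ∄smaller) → pure (m , Pm , λ k Pk → ≮⇒≥ (λ k<m → ∄smaller (k , k<m , Pk)))

¬¬-TwPlus1≤ : {G : Graph n} (D : TreeDecomp G X) → (∀ s → ∣ bag D s ∣ ≤ m) →
              DoubleNegation (∃ λ v → TwPlus1 G X v × v ≤ m)
¬¬-TwPlus1≤ {m = m} D bags≤m =
  ¬¬-map (λ (v , v-min@(_ , v-least)) → v , v-min , v-least m (D , bags≤m)) (¬¬-least _ (D , bags≤m))

proposition1p4 : ∀ {n} (G : Graph n) (t a c : ℕ) →
    TreeP TwPlus1 G t → TreeP Alpha G a → TreeP Chi G c → t ≤ a * c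
proposition1p4 G t a c (_ , t-least) ((Dα , α-bags) , _) ((Dχ , χ-bags) , _) =
  decidable-stable (t ≤? a * c)
    (¬¬-map (t-least (a * c) ∘ (Dα ,_)) (sequence rawApplicative bags-twPlus1≤a*c))
  where
  open RawMonad ¬¬-Monad using (rawApplicative)
  bags-twPlus1≤a*c : ∀ s → DoubleNegation (∃ λ v → TwPlus1 G (bag Dα s) v × v ≤ a * c)
  bags-twPlus1≤a*c s with α-bags s
  ... | _ , Alpha-bag , α≤a = ¬¬-TwPlus1≤ (restrict Dχ (bag Dα s) (λ _ → ∈⊤))
    (∣bag∩X∣≤a*c Dχ χ-bags (bag Dα s) (Alpha⇒IndependentSetsAtMost {G = G} Alpha-bag α≤a))
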